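{- Let $S[1\ldots n]$ be a string and let $i,j,k$ be positions with $1\le i<j\le k\le n$. If the left-bounded longest repeat starting at position $j$ does not exist or does not cover position $k$, then the left-bounded longest repeat starting at position $i$ does not exist or does not cover position $k$.
   Context: For a string $S[1\ldots n]$, $S[i\ldots j]=S[i]\cdots S[j]$, which covers position $k$ if $i\le k\le j$. A substring $S[i\ldots j]$ is unique if there is no other substring $S[i'\ldots j']$ equal to it with $i'\neq i$; a repeat is a non-unique substring. The left-bounded longest repeat starting at position $p$ is the repeat $S[p\ldots q]$ such that either $q=n$ or $S[p\ldots q+1]$ is unique; it exists iff the character $S[p]$ occurs at least twice in $S$. -}

module Defs where

open import Data.Nat using (ℕ; zero; suc; _+_; _∸_; _≤_)
open import Data.List using (List; []; _∷_; length)
open import Data.Maybe using (Maybe; just; nothing)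
open import Data.Product using (_×_; ∃-syntax)
open import Data.Sum using (_⊎_)
open import Relation.Binary.PropositionalEquality using (_≡_)
open import Relation.Nullary using (¬_)

-- 1-indexed character access: charAt S p = S[p] for 1 ≤ p ≤ length S
charAt : {A : Set} → List A → ℕ → Maybe A
charAt []       _             = nothing
charAt (x ∷ xs) zero          = nothing
charAt (x ∷ xs) (suc zero)    = just x
charAt (x ∷ xs) (suc (suc p)) = charAt xs (suc p)

Valid : {A : Set} → List A → ℕ → ℕ → Set
Valid S i j = 1 ≤ i × i ≤ j × j ≤ length S

SameSub : {A : Set} → List A → ℕ → ℕ → ℕ → ℕ → Set
SameSub S i j i' j' =
  Valid S i' j' × (j' ∸ i' ≡ j ∸ i) ×
  ((t : ℕ) → t ≤ j ∸ i → charAt S (i + t) ≡ charAt S (i' + t))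

Unique : {A : Set} → List A → ℕ → ℕ → Set
Unique S i j = Valid S i j × ((i' j' : ℕ) → SameSub S i j i' j' → i' ≡ i)

Repeat : {A : Set} → List A → ℕ → ℕ → Set
Repeat S i j = Valid S i j × ¬ Unique S i j

LLR : {A : Set} → List A → ℕ → ℕ → Set
LLR S p q = Repeat S p q × (q ≡ length S ⊎ Unique S p (suc q))

LLRCovers : {A : Set} → List A → ℕ → ℕ → Set
LLRCovers S p k = ∃[ q ] (LLR S p q × p ≤ k × k ≤ q)

module Submission where

open import Defs
open import Data.Nat using (ℕ; zero; suc; _+_; _∸_; _≤_; _<_; s≤s)
open import Data.Nat.Properties
open import Data.List using (List; length)
open import Data.Product using (_×_; _,_; ∃-syntax)
open import Data.Sum using (inj₁; inj₂)
open import Relation.Nullary using (¬_)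
open import Relation.Binary.PropositionalEquality

-- If the longest repeat S[i…q] at i covers k, then its suffix S[j…q] is still a repeat
-- (extending a unique substring to the left keeps it unique), and extending S[j…q] to the
-- right while it stays a repeat yields the longest repeat at j, which also covers k.
-- Uniqueness is undecidable over an arbitrary alphabet, so that extension only exists
-- under a double negation, which suffices because the goal is a negation.

SameSub-dropˡ : {A : Set} (S : List A) {i q i' j' : ℕ} (d : ℕ) → d ≤ q ∸ i →
                SameSub S i q i' j' → SameSub S (i + d) q (i' + d) j'
SameSub-dropˡ S {i} {q} {i'} {j'} d d≤ ((1≤i' , i'≤j' , j'≤n) , len , chars) =
  (≤-trans 1≤i' (m≤m+n i' d) , i'+d≤j' , j'≤n) , len' , chars'
  where
  d≤j'∸i' : d ≤ j' ∸ i'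
  d≤j'∸i' = subst (d ≤_) (sym len) d≤

  i'+d≤j' : i' + d ≤ j'
  i'+d≤j' = subst (_≤ j') (+-comm d i') (m≤o∸n⇒m+n≤o d i'≤j' d≤j'∸i')

  len' : j' ∸ (i' + d) ≡ q ∸ (i + d)
  len' = begin
    j' ∸ (i' + d)  ≡⟨ sym (∸-+-assoc j' i' d) ⟩
    j' ∸ i' ∸ d    ≡⟨ cong (_∸ d) len ⟩
    q ∸ i ∸ d      ≡⟨ ∸-+-assoc q i d ⟩
    q ∸ (i + d)    ∎
    where open ≡-Reasoning

  chars' : (t : ℕ) → t ≤ q ∸ (i + d) → charAt S (i + d + t) ≡ charAt S (i' + d + t)
  chars' t t≤ = begin
    charAt S (i + d + t)    ≡⟨ cong (charAt S) (+-assoc i d t) ⟩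
    charAt S (i + (d + t))  ≡⟨ chars (d + t) d+t≤ ⟩
    charAt S (i' + (d + t)) ≡⟨ cong (charAt S) (sym (+-assoc i' d t)) ⟩
    charAt S (i' + d + t)   ∎
    where
    open ≡-Reasoning
    d+t≤ : d + t ≤ q ∸ i
    d+t≤ = subst (_≤ q ∸ i) (+-comm t d)
             (m≤o∸n⇒m+n≤o t d≤ (subst (t ≤_) (sym (∸-+-assoc q i d)) t≤))

Unique-extendˡ : {A : Set} (S : List A) {i j q : ℕ} → 1 ≤ i → i ≤ j →
                 Unique S j q → Unique S i q
Unique-extendˡ S {i} {j} {q} 1≤i i≤j ((_ , j≤q , q≤n) , unique) =
  (1≤i , ≤-trans i≤j j≤q , q≤n) , unique'
  where
  d : ℕ
  d = j ∸ i

  i+d≡j : i + d ≡ j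
  i+d≡j = m+[n∸m]≡n i≤j

  unique' : (i' j' : ℕ) → SameSub S i q i' j' → i' ≡ i
  unique' i' j' same = +-cancelʳ-≡ d i' i (trans i'+d≡j (sym i+d≡j))
    where
    i'+d≡j : i' + d ≡ j
    i'+d≡j = unique (i' + d) j'
      (subst (λ x → SameSub S x q (i' + d) j') i+d≡j
        (SameSub-dropˡ S d (∸-monoˡ-≤ i j≤q) same))

Repeat-suffix : {A : Set} (S : List A) {i j q : ℕ} → i ≤ j → j ≤ q →
                Repeat S i q → Repeat S j q
Repeat-suffix S i≤j j≤q ((1≤i , _ , q≤n) , ¬unique) =
  (≤-trans 1≤i i≤j , j≤q , q≤n) , λ unique → ¬unique (Unique-extendˡ S 1≤i i≤j unique)

Repeat⇒¬¬LLR : {A : Set} (S : List A) {j : ℕ} (m q : ℕ) → m + q ≡ length S →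
               Repeat S j q → ¬ ¬ (∃[ q' ] (LLR S j q' × q ≤ q'))
Repeat⇒¬¬LLR S zero q q≡n rep noLLR = noLLR (q , (rep , inj₁ q≡n) , ≤-refl)
Repeat⇒¬¬LLR S {j} (suc m) q m+q≡n rep@((1≤j , j≤q , _) , _) noLLR =
  ¬¬unique λ unique → noLLR (q , (rep , inj₂ unique) , ≤-refl)
  where
  ¬¬unique : ¬ ¬ Unique S j (suc q)
  ¬¬unique ¬unique = Repeat⇒¬¬LLR S m (suc q) (trans (+-suc m q) m+q≡n)
    ((1≤j , m≤n⇒m≤1+n j≤q , subst (suc q ≤_) m+q≡n (s≤s (m≤n+m q m))) , ¬unique)
    (λ { (q' , llr , q<q') → noLLR (q' , llr , <⇒≤ q<q') })

lemma3 : {A : Set} (S : List A) (i j k : ℕ) →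
         1 ≤ i → i < j → j ≤ k → k ≤ length S →
         ¬ LLRCovers S j k → ¬ LLRCovers S i k
lemma3 S i j k _ i<j j≤k _ ¬coversʲ (q , (repⁱ@((_ , _ , q≤n) , _) , _) , _ , k≤q) =
  Repeat⇒¬¬LLR S (length S ∸ q) q (m∸n+n≡m q≤n) repʲ
    λ { (q' , llr , q≤q') → ¬coversʲ (q' , llr , j≤k , ≤-trans k≤q q≤q') }
  where
  repʲ : Repeat S j q
  repʲ = Repeat-suffix S (<⇒≤ i<j) (≤-trans j≤k k≤q) repⁱ
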